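{- For every integer $n\geq 3$, the path $P_n$ of order $n$ satisfies $\alpha_{mix}(P_n)=\lceil \frac{2n-1}{3}\rceil$.
   Context: For a graph $G=(V,E)$, a mixed independent set of $G$ is a subset of $V\cup E$ in which no two objects are adjacent (two vertices joined by an edge, or two edges sharing an endpoint) or incident (a vertex that is an endpoint of an edge). The mixed independence number $\alpha_{mix}(G)$ is the maximum cardinality of a mixed independent set of $G$. -}

module Defs where

open import Data.Nat using (ℕ; zero; suc; _+_; _*_; _∸_; _≤_; _<_; NonZero)
open import Data.Nat.DivMod using (_/_)
open import Data.Fin using (Fin; toℕ)
open import Data.List using (List; length)
open import Data.List.Membership.Propositional using (_∈_)
open import Data.List.Relation.Unary.Unique.Propositional using (Unique)
open import Data.Product using (Σ; _×_; _,_; ∃)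
open import Data.Sum using (_⊎_; inj₁; inj₂)
open import Data.Nat.Properties using (<-irrefl; n<1+n)
open import Relation.Binary.PropositionalEquality using (_≡_)
import Relation.Binary.PropositionalEquality
open import Relation.Nullary using (¬_)
open import Level using (0ℓ)

record Graph (n : ℕ) : Set₁ where
  field
    Adj     : Fin n → Fin n → Set
    sym     : ∀ {u v} → Adj u v → Adj v u
    irrefl  : ∀ {u} → ¬ Adj u u

open Graph public

-- Objects of G: elements of V ∪ E.
-- An edge {u,v} is represented canonically as (u , v) with toℕ u < toℕ v.
data Obj {n : ℕ} (G : Graph n) : Set where
  vtx : Fin n → Obj G
  edg : (u v : Fin n) → toℕ u < toℕ v → Adj G u v → Obj G

data Conflict {n : ℕ} {G : Graph n} : Obj G → Obj G → Set where
  vv  : ∀ {u v : Fin n} → Adj G u v → Conflict (vtx u) (vtx v)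
  ve  : ∀ {w u v : Fin n} {p : toℕ u < toℕ v} {a : Adj G u v} → (w ≡ u) ⊎ (w ≡ v) → Conflict (vtx w) (edg u v p a)
  ev  : ∀ {w u v : Fin n} {p : toℕ u < toℕ v} {a : Adj G u v} → (w ≡ u) ⊎ (w ≡ v) → Conflict (edg u v p a) (vtx w)
  ee  : ∀ {u v u' v' : Fin n} {p : toℕ u < toℕ v} {a : Adj G u v}
          {p' : toℕ u' < toℕ v'} {a' : Adj G u' v'} →
        ¬ (_≡_ {A = Obj G} (edg u v p a) (edg u' v' p' a')) →
        ((u ≡ u') ⊎ (u ≡ v') ⊎ (v ≡ u') ⊎ (v ≡ v')) →
        Conflict (edg u v p a) (edg u' v' p' a')

record MixedIndependent {n : ℕ} (G : Graph n) (S : List (Obj G)) : Set where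
  field
    unique      : Unique S
    independent : ∀ {x y} → x ∈ S → y ∈ S → ¬ Conflict x y

record IsMixedIndependenceNumber {n : ℕ} (G : Graph n) (k : ℕ) : Set where
  field
    witness    : List (Obj G)
    witnessMIS : MixedIndependent G witness
    witnessLen : length witness ≡ k
    maximal    : ∀ S → MixedIndependent G S → length S ≤ k

PathAdj : ∀ {n} → Fin n → Fin n → Set
PathAdj u v = (suc (toℕ u) ≡ toℕ v) ⊎ (suc (toℕ v) ≡ toℕ u)

private
  sucNotFix : ∀ {m : ℕ} → ¬ (suc m ≡ m)
  sucNotFix {m} e = <-irrefl (Relation.Binary.PropositionalEquality.sym e) (n<1+n m)

Path : (n : ℕ) → Graph n
Path n = record
  { Adj    = PathAdj
  ; sym    = λ { (inj₁ e) → inj₂ e ; (inj₂ e) → inj₁ e }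
  ; irrefl = λ { (inj₁ e) → sucNotFix e ; (inj₂ e) → sucNotFix e }
  }

⌈_/_⌉ : ℕ → (b : ℕ) → {{NonZero b}} → ℕ
⌈ a / b ⌉ = (a + (b ∸ 1)) / b

-- List the objects of P_n in the order v₀, v₀v₁, v₁, v₁v₂, …, v_{n-1}, so that
-- vertex i sits at position 2i and edge {i, i+1} at position 2i+1; these are the
-- 2n-1 positions 0, …, 2n-2. Two distinct objects conflict exactly when their
-- positions differ by 1 or 2. Hence a mixed independent set meets every block
-- {3q, 3q+1, 3q+2} of positions at most once, giving at most ⌈(2n-1)/3⌉ objects,
-- and the objects at positions 0, 3, 6, … form a mixed independent set of that size.
module Submission where

open import Defs hiding (sym)
open import Data.Nat using (ℕ; zero; suc; _+_; _*_; _∸_; _≤_; _<_; z≤n; s≤s)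
open import Data.Nat.Properties
open import Data.Nat.DivMod using (_/_; _%_; m≡m%n+[m/n]*n; m%n<n; m/n*n≤m; m/n≡1+[m∸n]/n; /-monoˡ-≤)
open import Data.Fin using (Fin; toℕ; fromℕ<)
open import Data.Fin.Properties using (toℕ-injective; toℕ-fromℕ<; toℕ<n; injective⇒≤)
open import Data.List using (List; _∷_; length; lookup; tabulate)
open import Data.List.Properties using (length-tabulate)
open import Data.List.Membership.Propositional using (_∈_)
open import Data.List.Membership.Propositional.Properties using (∈-lookup; ∈-tabulate⁻)
open import Data.List.Relation.Unary.All as All using (All)
open import Data.List.Relation.Unary.AllPairs using (_∷_)
open import Data.List.Relation.Unary.Unique.Propositional using (Unique)
open import Data.List.Relation.Unary.Unique.Propositional.Properties using (tabulate⁺)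
open import Data.Product using (∃; _×_; _,_; proj₁; proj₂)
open import Data.Sum using (_⊎_; inj₁; inj₂)
open import Data.Empty using (⊥-elim)
open import Function.Definitions using (Injective)
open import Relation.Binary.Definitions using (tri<; tri≈; tri>)
open import Relation.Binary.PropositionalEquality using (_≡_; _≢_; refl; sym; trans; cong; subst; subst₂; module ≡-Reasoning)
open import Relation.Nullary using (¬_; contradiction)

private
  variable
    A : Set

j<⌈m/1+n⌉⇒j*[1+n]<m : ∀ {j m n} → j < ⌈ m / suc n ⌉ → j * suc n < m
j<⌈m/1+n⌉⇒j*[1+n]<m {j} {m} {n} j<⌈m/1+n⌉ = +-cancelˡ-≤ n _ _ (begin
  n + suc (j * suc n)     ≡⟨ +-suc n _ ⟩
  suc j * suc n           ≤⟨ *-monoˡ-≤ (suc n) j<⌈m/1+n⌉ ⟩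
  ⌈ m / suc n ⌉ * suc n   ≤⟨ m/n*n≤m (m + n) (suc n) ⟩
  m + n                   ≡⟨ +-comm m n ⟩
  n + m                   ∎)
  where open ≤-Reasoning

i<m⇒i/[1+n]<⌈m/1+n⌉ : ∀ {i m n} → i < m → i / suc n < ⌈ m / suc n ⌉
i<m⇒i/[1+n]<⌈m/1+n⌉ {i} {m} {n} i<m = begin
  suc (i / suc n)                   ≡⟨ cong (λ k → suc (k / suc n)) (sym (m+n∸n≡m i (suc n))) ⟩
  suc ((i + suc n ∸ suc n) / suc n) ≡⟨ sym (m/n≡1+[m∸n]/n (m≤n+m (suc n) i)) ⟩
  (i + suc n) / suc n               ≤⟨ /-monoˡ-≤ (suc n) (subst (_≤ m + n) (sym (+-suc i n)) (+-monoˡ-≤ n i<m)) ⟩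
  ⌈ m / suc n ⌉                     ∎
  where open ≤-Reasoning

lookup-injective : {xs : List A} → Unique xs → ∀ {i j} → lookup xs i ≡ lookup xs j → i ≡ j
lookup-injective (_  ∷ _) {Fin.zero}  {Fin.zero}  _  = refl
lookup-injective (x∉ ∷ _) {Fin.zero}  {Fin.suc j} eq = contradiction eq (All.lookup x∉ (∈-lookup j))
lookup-injective (x∉ ∷ _) {Fin.suc i} {Fin.zero}  eq = contradiction (sym eq) (All.lookup x∉ (∈-lookup i))
lookup-injective (_  ∷ u) {Fin.suc i} {Fin.suc j} eq = cong Fin.suc (lookup-injective u eq)

injectiveOn⇒length≤ : {xs : List A} (f : A → ℕ) {c : ℕ} → Unique xs →
                      (∀ {x y} → x ∈ xs → y ∈ xs → f x ≡ f y → x ≡ y) →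
                      All (λ x → f x < c) xs → length xs ≤ c
injectiveOn⇒length≤ {xs = xs} f {c} unique injectiveOn bounded = injective⇒≤ g-injective
  where
  g : Fin (length xs) → Fin c
  g i = fromℕ< (All.lookup bounded (∈-lookup i))

  g-injective : Injective _≡_ _≡_ g
  g-injective {i} {j} gi≡gj = lookup-injective unique
    (injectiveOn (∈-lookup i) (∈-lookup j)
      (trans (sym (toℕ-fromℕ< _)) (trans (cong toℕ gi≡gj) (toℕ-fromℕ< _))))

Close : ℕ → ℕ → Set
Close x y = y ≡ 1 + x ⊎ y ≡ 2 + x

close-intro : ∀ {x y} → x < y → y ≤ 2 + x → Close x y
close-intro {zero}  {suc zero}          _ _ = inj₁ refl
close-intro {zero}  {suc (suc zero)}    _ _ = inj₂ refl
close-intro {zero}  {suc (suc (suc _))} _ (s≤s (s≤s ()))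
close-intro {suc x} {suc y} (s≤s x<y) (s≤s y≤2+x) with close-intro x<y y≤2+x
... | inj₁ e = inj₁ (cong suc e)
... | inj₂ e = inj₂ (cong suc e)

close-bounds : ∀ {x y} → Close x y → x < y × y ≤ 2 + x
close-bounds {x} (inj₁ refl) = n<1+n x , n≤1+n (suc x)
close-bounds {x} (inj₂ refl) = m<n+m x (s≤s z≤n) , ≤-refl

same-/3⇒close : ∀ {x y} → x < y → x / 3 ≡ y / 3 → Close x y
same-/3⇒close {x} {y} x<y x/3≡y/3 = close-intro x<y (begin
  y                   ≡⟨ m≡m%n+[m/n]*n y 3 ⟩
  y % 3 + y / 3 * 3   ≤⟨ +-monoˡ-≤ (y / 3 * 3) (≤-pred (m%n<n y 3)) ⟩
  2 + y / 3 * 3       ≡⟨ cong (λ q → 2 + q * 3) (sym x/3≡y/3) ⟩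
  2 + x / 3 * 3       ≤⟨ +-monoʳ-≤ 2 (m/n*n≤m x 3) ⟩
  2 + x               ∎)
  where open ≤-Reasoning

¬close-*3 : ∀ i j → ¬ Close (i * 3) (j * 3)
¬close-*3 i j close with close-bounds close
... | i*3<j*3 , j*3≤2+i*3 =
  <-irrefl refl (≤-trans (*-monoˡ-≤ 3 (*-cancelʳ-< 3 i j i*3<j*3)) j*3≤2+i*3)

≡1+⇒2*≡2+2* : ∀ {m k} → m ≡ suc k → 2 * m ≡ 2 + 2 * k
≡1+⇒2*≡2+2* {k = k} refl = *-suc 2 k

2*-injective : ∀ {m k} → 2 * m ≡ 2 * k → m ≡ k
2*-injective = *-cancelˡ-≡ _ _ 2

2*-cancel-< : ∀ {m k} → 2 * m < 2 * k → m < k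
2*-cancel-< = *-cancelˡ-< 2 _ _

m<n⇒1+2*m<2*n : ∀ {m n} → m < n → suc (2 * m) < 2 * n
m<n⇒1+2*m<2*n {m} {n} m<n = subst (_≤ 2 * n) (*-suc 2 m) (*-monoʳ-≤ 2 m<n)

1+m<n⇒m<n∸1 : ∀ {m} n → suc m < n → m < n ∸ 1
1+m<n⇒m<n∸1 (suc n) (s≤s m<n) = m<n

m<n∸1⇒1+m<n : ∀ {m} n → m < n ∸ 1 → suc m < n
m<n∸1⇒1+m<n (suc n) m<n = s≤s m<n

even⊎odd : ∀ p → (∃ λ q → p ≡ 2 * q) ⊎ (∃ λ q → p ≡ suc (2 * q))
even⊎odd zero = inj₁ (0 , refl)
even⊎odd (suc p) with even⊎odd p
... | inj₁ (q , refl) = inj₂ (q , refl)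
... | inj₂ (q , refl) = inj₁ (suc q , sym (*-suc 2 q))

module _ {n : ℕ} where

  Object : Set
  Object = Obj (Path n)

  position : Object → ℕ
  position (vtx u)       = 2 * toℕ u
  position (edg u _ _ _) = suc (2 * toℕ u)

  right-end : ∀ {u v : Fin n} → toℕ u < toℕ v → PathAdj u v → toℕ v ≡ suc (toℕ u)
  right-end _   (inj₁ e) = sym e
  right-end u<v (inj₂ e) = ⊥-elim (<-asym u<v (≤-reflexive e))

  PathAdj-irrelevant : ∀ {u v : Fin n} → toℕ u < toℕ v → (a b : PathAdj u v) → a ≡ b
  PathAdj-irrelevant _   (inj₁ e) (inj₁ e′) = cong inj₁ (≡-irrelevant e e′)
  PathAdj-irrelevant u<v (inj₂ e) _         = ⊥-elim (<-asym u<v (≤-reflexive e))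
  PathAdj-irrelevant u<v (inj₁ _) (inj₂ e)  = ⊥-elim (<-asym u<v (≤-reflexive e))

  edg-≡ : ∀ {u v u′ v′ : Fin n} p a p′ a′ → u ≡ u′ → _≡_ {A = Object} (edg u v p a) (edg u′ v′ p′ a′)
  edg-≡ p a p′ a′ refl with toℕ-injective (trans (right-end p a) (sym (right-end p′ a′)))
  ... | refl rewrite ≤-irrelevant p p′ | PathAdj-irrelevant p′ a a′ = refl

  position-injective : ∀ {a b} → position a ≡ position b → a ≡ b
  position-injective {vtx u}         {vtx v}         e = cong vtx (toℕ-injective (2*-injective e))
  position-injective {vtx u}         {edg w _ _ _}   e = ⊥-elim (even≢odd (toℕ u) (toℕ w) e)
  position-injective {edg w _ _ _}   {vtx u}         e = ⊥-elim (even≢odd (toℕ u) (toℕ w) (sym e))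
  position-injective {edg _ _ p a}   {edg _ _ p′ a′} e =
    edg-≡ p a p′ a′ (toℕ-injective (2*-injective (suc-injective e)))

  1+position<2n : (o : Object) → suc (position o) < 2 * n
  1+position<2n (vtx u)       = m<n⇒1+2*m<2*n (toℕ<n u)
  1+position<2n (edg u v p a) =
    subst (_< 2 * n) (≡1+⇒2*≡2+2* (right-end p a)) (<-trans (n<1+n _) (m<n⇒1+2*m<2*n (toℕ<n v)))

  position-surjective : ∀ {p} → suc p < 2 * n → ∃ λ (o : Object) → position o ≡ p
  position-surjective {p} 1+p<2n with even⊎odd p
  ... | inj₁ (q , refl) = vtx (fromℕ< q<n) , cong (2 *_) (toℕ-fromℕ< q<n)
    where
    q<n : q < n
    q<n = 2*-cancel-< (<-trans (n<1+n _) 1+p<2n)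
  ... | inj₂ (q , refl) = edg u v u<v u~v , cong (λ k → suc (2 * k)) (toℕ-fromℕ< q<n)
    where
    1+q<n : suc q < n
    1+q<n = 2*-cancel-< (subst (_< 2 * n) (sym (*-suc 2 q)) 1+p<2n)
    q<n : q < n
    q<n = <-trans (n<1+n q) 1+q<n
    u v : Fin n
    u = fromℕ< q<n
    v = fromℕ< 1+q<n
    v≡1+u : toℕ v ≡ suc (toℕ u)
    v≡1+u = trans (toℕ-fromℕ< 1+q<n) (cong suc (sym (toℕ-fromℕ< q<n)))
    u<v : toℕ u < toℕ v
    u<v = ≤-reflexive (sym v≡1+u)
    u~v : PathAdj u v
    u~v = inj₁ (sym v≡1+u)

  close⇒distinct : ∀ {a b} → Close (position a) (position b) → a ≢ b
  close⇒distinct close refl = <-irrefl refl (proj₁ (close-bounds close))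

  close⇒Conflict : ∀ a b → Close (position a) (position b) → Conflict a b
  close⇒Conflict (vtx w) (vtx v) (inj₁ e) = ⊥-elim (even≢odd (toℕ v) (toℕ w) e)
  close⇒Conflict (vtx w) (vtx v) (inj₂ e) =
    vv (inj₁ (sym (2*-injective (trans e (sym (*-suc 2 (toℕ w)))))))
  close⇒Conflict (vtx w) (edg u v p a) (inj₁ e) =
    ve (inj₁ (toℕ-injective (2*-injective (sym (suc-injective e)))))
  close⇒Conflict (vtx w) (edg u v p a) (inj₂ e) = ⊥-elim (even≢odd (toℕ u) (toℕ w) (suc-injective e))
  close⇒Conflict (edg u v p a) (vtx w) (inj₁ e) =
    ev (inj₂ (toℕ-injective (2*-injective (trans e (sym (≡1+⇒2*≡2+2* (right-end p a)))))))
  close⇒Conflict (edg u v p a) (vtx w) (inj₂ e) =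
    ⊥-elim (even≢odd (toℕ w) (suc (toℕ u)) (trans e (cong suc (sym (*-suc 2 (toℕ u))))))
  close⇒Conflict (edg u v p a) (edg u′ v′ p′ a′) (inj₁ e) =
    ⊥-elim (even≢odd (toℕ u′) (toℕ u) (suc-injective e))
  close⇒Conflict (edg u v p a) (edg u′ v′ p′ a′) close@(inj₂ e) =
    ee (close⇒distinct close) (inj₂ (inj₂ (inj₁ (toℕ-injective v≡u′))))
    where
    v≡u′ : toℕ v ≡ toℕ u′
    v≡u′ = 2*-injective (trans (≡1+⇒2*≡2+2* (right-end p a)) (sym (suc-injective e)))

  Conflict⇒close : ∀ {a b} → Conflict a b →
                   Close (position a) (position b) ⊎ Close (position b) (position a)
  Conflict⇒close (vv (inj₁ e))                 = inj₁ (inj₂ (≡1+⇒2*≡2+2* (sym e)))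
  Conflict⇒close (vv (inj₂ e))                 = inj₂ (inj₂ (≡1+⇒2*≡2+2* (sym e)))
  Conflict⇒close (ve (inj₁ refl))              = inj₁ (inj₁ refl)
  Conflict⇒close (ve {p = p} {a} (inj₂ refl))  = inj₂ (inj₁ (≡1+⇒2*≡2+2* (right-end p a)))
  Conflict⇒close (ev (inj₁ refl))              = inj₂ (inj₁ refl)
  Conflict⇒close (ev {p = p} {a} (inj₂ refl))  = inj₁ (inj₁ (≡1+⇒2*≡2+2* (right-end p a)))
  Conflict⇒close (ee {p = p} {a} {p′} {a′} distinct (inj₁ u≡u′)) = ⊥-elim (distinct (edg-≡ p a p′ a′ u≡u′))
  Conflict⇒close (ee {p' = p′} {a' = a′} _ (inj₂ (inj₁ refl))) =
    inj₂ (inj₂ (cong suc (≡1+⇒2*≡2+2* (right-end p′ a′))))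
  Conflict⇒close (ee {p = p} {a} _ (inj₂ (inj₂ (inj₁ refl)))) =
    inj₁ (inj₂ (cong suc (≡1+⇒2*≡2+2* (right-end p a))))
  Conflict⇒close (ee {p = p} {a} {p′} {a′} distinct (inj₂ (inj₂ (inj₂ refl)))) =
    ⊥-elim (distinct (edg-≡ p a p′ a′ (toℕ-injective (suc-injective (trans (sym (right-end p a)) (right-end p′ a′))))))

  MixedIndependent⇒/3-injective : ∀ {S} → MixedIndependent (Path n) S → ∀ {a b} → a ∈ S → b ∈ S →
                                  position a / 3 ≡ position b / 3 → a ≡ b
  MixedIndependent⇒/3-injective mis {a} {b} a∈S b∈S a/3≡b/3 with <-cmp (position a) (position b)
  ... | tri< a<b _ _ = ⊥-elim (MixedIndependent.independent mis a∈S b∈S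
                         (close⇒Conflict a b (same-/3⇒close a<b a/3≡b/3)))
  ... | tri≈ _ a≡b _ = position-injective a≡b
  ... | tri> _ _ b<a = ⊥-elim (MixedIndependent.independent mis b∈S a∈S
                         (close⇒Conflict b a (same-/3⇒close b<a (sym a/3≡b/3))))

  MixedIndependent⇒length≤ : ∀ S → MixedIndependent (Path n) S → length S ≤ ⌈ 2 * n ∸ 1 / 3 ⌉
  MixedIndependent⇒length≤ S mis =
    injectiveOn⇒length≤ (λ o → position o / 3) (MixedIndependent.unique mis)
      (MixedIndependent⇒/3-injective mis)
      (All.tabulate (λ {o} _ → i<m⇒i/[1+n]<⌈m/1+n⌉ (1+m<n⇒m<n∸1 (2 * n) (1+position<2n o))))

  spacedObject : Fin ⌈ 2 * n ∸ 1 / 3 ⌉ → Object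
  spacedObject j = proj₁ (position-surjective (m<n∸1⇒1+m<n (2 * n) (j<⌈m/1+n⌉⇒j*[1+n]<m (toℕ<n j))))

  position-spacedObject : ∀ j → position (spacedObject j) ≡ toℕ j * 3
  position-spacedObject j = proj₂ (position-surjective _)

  spacedObject-injective : Injective _≡_ _≡_ spacedObject
  spacedObject-injective {i} {j} e = toℕ-injective (*-cancelʳ-≡ _ _ 3 (begin
    toℕ i * 3                 ≡⟨ sym (position-spacedObject i) ⟩
    position (spacedObject i) ≡⟨ cong position e ⟩
    position (spacedObject j) ≡⟨ position-spacedObject j ⟩
    toℕ j * 3                 ∎))
    where open ≡-Reasoning

  spacedObjects-nonConflicting : ∀ i j → ¬ Conflict (spacedObject i) (spacedObject j)
  spacedObjects-nonConflicting i j conflict with Conflict⇒close conflict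
  ... | inj₁ close = ¬close-*3 (toℕ i) (toℕ j)
                       (subst₂ Close (position-spacedObject i) (position-spacedObject j) close)
  ... | inj₂ close = ¬close-*3 (toℕ j) (toℕ i)
                       (subst₂ Close (position-spacedObject j) (position-spacedObject i) close)

  spacedObjects-mixedIndependent : MixedIndependent (Path n) (tabulate spacedObject)
  spacedObjects-mixedIndependent = record
    { unique      = tabulate⁺ spacedObject-injective
    ; independent = independent
    }
    where
    independent : ∀ {a b} → a ∈ tabulate spacedObject → b ∈ tabulate spacedObject → ¬ Conflict a b
    independent a∈ b∈ with ∈-tabulate⁻ a∈ | ∈-tabulate⁻ b∈
    ... | i , refl | j , refl = spacedObjects-nonConflicting i j

lemma3p2 : (n : ℕ) → 3 ≤ n →
    IsMixedIndependenceNumber (Path n) ⌈ 2 * n ∸ 1 / 3 ⌉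
lemma3p2 n _ = record
  { witness    = tabulate (spacedObject {n})
  ; witnessMIS = spacedObjects-mixedIndependent
  ; witnessLen = length-tabulate (spacedObject {n})
  ; maximal    = MixedIndependent⇒length≤
  }
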